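{- Let $j\geq 2$ be an integer and let $n$ be a positive integer such that the sequence $n, T(n),\ldots,T^{j-1}(n)$ contains exactly one even term. Then at least one of the following holds: (1) $\displaystyle n \geq \frac{2^{j+1}}{3j^2} - 1$; (2) there exist an integer $k<j$ and an odd integer $b=T^k(n)+1$ such that the triple $(1,b,b+1)$ is a $\mu$-hit.
   Context: The Collatz map is $T(n)=(3n+1)/2$ if $n$ is odd and $T(n)=n/2$ if $n$ is even, with $T^0(n)=n$. The function $\mu:\mathbb{Z}_{\geq1}\to\mathbb{R}_{\geq 0}$ is defined by $\mu(p_1^{n_1}\cdots p_r^{n_r})=\log(p_1\cdots p_r)+\log(n_1\cdots n_r)$ for distinct primes $p_1,\ldots,p_r$ and positive integers $n_1,\ldots,n_r$ (natural logarithm; $\mu(1)=0$). A $\mu$-hit is a triple $(a,b,c)$ of positive integers with $a+b=c$, $\gcd(a,b)=1$ and $\log c>\mu(abc)$. -}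

module Defs where

open import Data.Nat using (ℕ; zero; suc; _+_; _*_; _^_; _≤_; _<_; _/_; _%_)
open import Data.Nat.Divisibility using (_∣?_)
open import Data.Nat.Primality using (prime?)
open import Data.Nat.GCD using (gcd)
open import Data.Bool using (if_then_else_; _∧_)
open import Relation.Nullary using (does)
open import Relation.Binary.PropositionalEquality using (_≡_)
open import Data.Product using (_×_)
open import Data.Nat using (_≟_)

T : ℕ → ℕ
T n = if does (n % 2 ≟ 0) then n / 2 else (3 * n + 1) / 2

T^ : ℕ → ℕ → ℕ
T^ zero    n = n
T^ (suc k) n = T (T^ k n)

countEven : ℕ → ℕ → ℕ
countEven zero    n = 0
countEven (suc j) n =
  (if does (T^ j n % 2 ≟ 0) then 1 else 0) + countEven j n

-- p-adic valuation v_p(m) (with fuel; fuel = m suffices since v_p(m) ≤ m);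
-- returns 0 for p < 2 or m = 0.
valF : ℕ → ℕ → ℕ → ℕ
valF zero       p             m = 0
valF (suc fuel) zero          m = 0
valF (suc fuel) (suc zero)    m = 0
valF (suc fuel) (suc (suc q)) zero = 0
valF (suc fuel) p@(suc (suc q)) m@(suc _) =
  if does (p ∣? m) then suc (valF fuel p (m / p)) else 0

val : ℕ → ℕ → ℕ
val p m = valF m p m

radUpTo : ℕ → ℕ → ℕ
radUpTo m zero    = 1
radUpTo m (suc k) =
  (if does (prime? (suc k)) ∧ does (suc k ∣? m) then suc k else 1) * radUpTo m k

expUpTo : ℕ → ℕ → ℕ
expUpTo m zero    = 1
expUpTo m (suc k) =
  (if does (prime? (suc k)) ∧ does (suc k ∣? m) then val (suc k) m else 1) * expUpTo m k

-- For m = p1^n1 ⋯ pr^nr (m ≥ 1):  rad m = p1⋯pr,  expProd m = n1⋯nr,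
-- so that μ(m) = log (rad m) + log (expProd m) = log (rad m * expProd m).
rad : ℕ → ℕ
rad m = radUpTo m m

expProd : ℕ → ℕ
expProd m = expUpTo m m

-- μ-hit: a+b=c, gcd(a,b)=1, log c > μ(abc), i.e. c > rad(abc)·expProd(abc)
-- (exp is strictly increasing, so log c > log(X) ⇔ c > X).
μ-hit : ℕ → ℕ → ℕ → Set
μ-hit a b c =
  (1 ≤ a) × (1 ≤ b) × (a + b ≡ c) × (gcd a b ≡ 1)
  × (rad (a * b * c) * expProd (a * b * c) < c)

{-# OPTIONS --safe #-}
module Submission where

-- Let T^k(n) be the only even term among the first j, and write j = k + 1 + L.
-- Along an odd run T acts as m + 1 ↦ 3(m + 1)/2, so the run before T^k(n) gives
-- n + 1 = 2^k c and b := T^k(n) + 1 = 3^k c, and the run after it gives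
-- b + 1 = 2 (T^(k+1)(n) + 1) = 2^(L+1) d.  Since e^μ is multiplicative on coprime
-- numbers and e^μ(p^a r) ≤ p a r, we get e^μ(b) ≤ 3kc (or ≤ b = c if k = 0) and
-- e^μ(b + 1) ≤ 2(L+1)d.  If (1) fails, 3 j² c 2^k < 2^(j+1), and 4k(L+1) ≤ j²
-- turns this into e^μ(b) e^μ(b + 1) < 2^(L+1) d = b + 1: (1, b, b + 1) is a μ-hit.

open import Defs
open import Data.Nat using (ℕ; _+_; _*_; _^_; _≤_; _<_; _%_)
open import Data.Product using (Σ; _×_)
open import Data.Sum using (_⊎_)
open import Relation.Binary.PropositionalEquality using (_≡_)

open import Data.Bool using (true; false; if_then_else_; _∧_)
open import Data.Bool.Properties using (∧-zeroʳ)
open import Data.List using ([]; _∷_)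
open import Data.Nat using (suc; zero; z≤n; s≤s; z<s; NonTrivial; 2+; _≟_; _≤?_)
open import Data.Nat.Base
  using (nonTrivial⇒nonZero; nonTrivial⇒n>1; nonTrivial⇒≢1; >-nonZero)
open import Data.Nat.Divisibility
open import Data.Nat.DivMod using (_/_; m≡m%n+[m/n]*n; m%n<n; m*n/n≡m; %-distribˡ-+)
open import Data.Nat.GCD using (gcd-zeroˡ)
open import Data.Nat.Induction using (<-wellFounded)
open import Data.Nat.Primality
open import Data.Nat.Properties
open import Data.Nat.Tactic.RingSolver using (solve)
open import Data.Product using (_,_; ∃₂; ∃-syntax)
open import Data.Sum using (inj₁; inj₂)
open import Function using (_∘_)
open import Induction.WellFounded using (Acc; acc)
open import Relation.Binary.PropositionalEquality
  using (_≢_; refl; sym; trans; cong; cong₂; subst; subst₂; ≢-sym; module ≡-Reasoning)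
open import Relation.Nullary using (¬_; yes; no; does; contradiction)
open import Relation.Nullary.Decidable using (dec-true; dec-false; from-yes; toSum)

open import Algebra.Properties.CommutativeSemigroup *-commutativeSemigroup
  using (interchange; x∙yz≈y∙xz; x∙yz≈xz∙y)

n<p^n : ∀ {p} → 1 < p → ∀ n → n < p ^ n
n<p^n 1<p zero = z<s
n<p^n {p@(suc _)} 1<p (suc n) = begin-strict
  suc n      ≤⟨ n<p^n 1<p n ⟩
  p ^ n      <⟨ m<m*n (p ^ n) p {{m^n≢0 p n}} 1<p ⟩
  p ^ n * p  ≡⟨ *-comm (p ^ n) p ⟩
  p ^ suc n  ∎
  where open ≤-Reasoning

p*n≤p^n : ∀ {p} → 1 < p → ∀ {n} → 0 < n → p * n ≤ p ^ n
p*n≤p^n {p} 1<p {suc n} _ = *-monoʳ-≤ p (n<p^n 1<p n)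

m+n≤m*p^n : ∀ {p} → 1 < p → ∀ {m} n → 0 < m → m + n ≤ m * p ^ n
m+n≤m*p^n {p@(suc _)} 1<p {suc m} n _ = begin
  suc m + n          ≡⟨ cong suc (+-comm m n) ⟩
  suc n + m          ≤⟨ +-mono-≤ (n<p^n 1<p n) (m≤m*n m (p ^ n) {{m^n≢0 p n}}) ⟩
  p ^ n + m * p ^ n  ∎
  where open ≤-Reasoning

∤⇒>0 : ∀ {p r} → ¬ p ∣ r → 0 < r
∤⇒>0 {p} {zero} p∤0 = contradiction (p ∣0) p∤0
∤⇒>0 {r = suc _} _  = z<s

m*n>0⇒n>0 : ∀ m {n} → 0 < m * n → 0 < n
m*n>0⇒n>0 m {zero}  m*0>0 = contradiction (*-zeroʳ m) (n>0⇒n≢0 m*0>0)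
m*n>0⇒n>0 m {suc n} _     = z<s

-- p-adic valuations

valF-p* : ∀ f p .{{_ : NonTrivial p}} m → 0 < m → valF (suc f) p (p * m) ≡ suc (valF f p m)
valF-p* f p@(2+ _) m@(suc _) _ rewrite dec-true (p ∣? p * m) (m∣m*n m) =
  cong (suc ∘ valF f p) (trans (cong (_/ p) (*-comm p m)) (m*n/n≡m m p))

valF-∤ : ∀ f p .{{_ : NonTrivial p}} m → ¬ p ∣ m → valF (suc f) p m ≡ 0
valF-∤ f p@(2+ _) zero    p∤m = refl
valF-∤ f p@(2+ _) (suc _) p∤m rewrite dec-false (p ∣? _) p∤m = refl

valF-^* : ∀ f p .{{_ : NonTrivial p}} a {r} → ¬ p ∣ r → a ≤ f →
          valF f p (p ^ a * r) ≡ a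
valF-^* zero    p zero    p∤r _ = refl
valF-^* (suc f) p zero {r} p∤r _ rewrite *-identityˡ r = valF-∤ f p r p∤r
valF-^* (suc f) p (suc a) {r} p∤r (s≤s a≤f) = begin
  valF (suc f) p (p * p ^ a * r)    ≡⟨ cong (valF (suc f) p) (*-assoc p (p ^ a) r) ⟩
  valF (suc f) p (p * (p ^ a * r))  ≡⟨ valF-p* f p (p ^ a * r) p^a*r>0 ⟩
  suc (valF f p (p ^ a * r))        ≡⟨ cong suc (valF-^* f p a p∤r a≤f) ⟩
  suc a                             ∎
  where
  open ≡-Reasoning
  p^a*r>0 : 0 < p ^ a * r
  p^a*r>0 = *-mono-≤ (m^n>0 p {{nonTrivial⇒nonZero p}} a) (∤⇒>0 p∤r)

val-^* : ∀ p .{{_ : NonTrivial p}} a {r} → ¬ p ∣ r → val p (p ^ a * r) ≡ a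
val-^* p a {r} p∤r = valF-^* (p ^ a * r) p a p∤r a≤p^a*r
  where
  a≤p^a*r : a ≤ p ^ a * r
  a≤p^a*r = ≤-trans (<⇒≤ (n<p^n (nonTrivial⇒n>1 p) a))
                    (m≤m*n (p ^ a) r {{>-nonZero (∤⇒>0 p∤r)}})

val-^ : ∀ p .{{_ : NonTrivial p}} a → val p (p ^ a) ≡ a
val-^ p a = trans (cong (val p) (sym (*-identityʳ (p ^ a))))
                  (val-^* p a (λ p∣1 → nonTrivial⇒≢1 {p} (∣1⇒≡1 p∣1)))

factor-out-power : ∀ p .{{_ : NonTrivial p}} x → 0 < x →
                   ∃₂ λ a r → x ≡ p ^ a * r × ¬ p ∣ r
factor-out-power p x x>0 = go x x>0 (<-wellFounded x)
  where
  go : ∀ x → 0 < x → Acc _<_ x → ∃₂ λ a r → x ≡ p ^ a * r × ¬ p ∣ r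
  go x x>0 (acc rec) with p ∣? x
  ... | no p∤x = 0 , x , sym (*-identityˡ x) , p∤x
  ... | yes (divides zero refl) = contradiction x>0 λ ()
  ... | yes (divides y@(suc _) refl) with go y z<s (rec (m<m*n y p (nonTrivial⇒n>1 p)))
  ...   | a , r , y≡p^a*r , p∤r = suc a , r , y*p≡p^[1+a]*r , p∤r
    where
    y*p≡p^[1+a]*r : y * p ≡ p * p ^ a * r
    y*p≡p^[1+a]*r = trans (cong (_* p) y≡p^a*r)
                          (trans (*-comm (p ^ a * r) p) (sym (*-assoc p (p ^ a) r)))

prime[3] : Prime 3
prime[3] = from-yes (prime? 3)

prime⇒>1 : ∀ {p} → Prime p → 1 < p
prime⇒>1 {p} pp = nonTrivial⇒n>1 p {{prime⇒nonTrivial pp}}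

prime⇒≢1 : ∀ {p} → Prime p → p ≢ 1
prime⇒≢1 pp = nonTrivial⇒≢1 {{prime⇒nonTrivial pp}}

prime∤-* : ∀ {p x y} → Prime p → ¬ p ∣ x → ¬ p ∣ y → ¬ p ∣ x * y
prime∤-* {x = x} {y} pp p∤x p∤y p∣xy with euclidsLemma x y pp p∣xy
... | inj₁ p∣x = p∤x p∣x
... | inj₂ p∣y = p∤y p∣y

prime∣p^n⇒∣p : ∀ {q p} n → Prime q → q ∣ p ^ n → q ∣ p
prime∣p^n⇒∣p zero pq q∣1 = contradiction (∣1⇒≡1 q∣1) (prime⇒≢1 pq)
prime∣p^n⇒∣p {p = p} (suc n) pq q∣p^[1+n] with euclidsLemma p (p ^ n) pq q∣p^[1+n]
... | inj₁ q∣p   = q∣p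
... | inj₂ q∣p^n = prime∣p^n⇒∣p n pq q∣p^n

prime∣p^n⇒≡ : ∀ {q p} n → Prime q → Prime p → q ∣ p ^ n → q ≡ p
prime∣p^n⇒≡ n pq pp q∣p^n with prime⇒irreducible pp (prime∣p^n⇒∣p n pq q∣p^n)
... | inj₁ q≡1 = contradiction q≡1 (prime⇒≢1 pq)
... | inj₂ q≡p = q≡p

p∣p^n : ∀ {p n} → 0 < n → p ∣ p ^ n
p∣p^n {p} {suc n} _ = m∣m*n (p ^ n)

p^n∣m*x⇒p^n∣x : ∀ {p m} → Prime p → ¬ p ∣ m → ∀ n {x} →
                p ^ n ∣ m * x → p ^ n ∣ x
p^n∣m*x⇒p^n∣x pp p∤m zero {x} _ = 1∣ x
p^n∣m*x⇒p^n∣x {p} {m} pp p∤m (suc n) {x} p^[1+n]∣m*x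
  with euclidsLemma m x pp (m*n∣⇒m∣ p (p ^ n) p^[1+n]∣m*x)
... | inj₁ p∣m = contradiction p∣m p∤m
... | inj₂ (divides y refl) =
  subst (p * p ^ n ∣_) (*-comm p y) (*-monoʳ-∣ p (p^n∣m*x⇒p^n∣x pp p∤m n p^n∣m*y))
  where
  p^n∣m*y : p ^ n ∣ m * y
  p^n∣m*y = *-cancelˡ-∣ p {{prime⇒nonZero pp}}
    (subst (p * p ^ n ∣_) (trans (sym (*-assoc m y p)) (*-comm (m * y) p)) p^[1+n]∣m*x)

PrimeDisjoint : ℕ → ℕ → Set
PrimeDisjoint x y = ∀ {q} → Prime q → q ∣ x → ¬ q ∣ y

primeDisjoint-+1 : ∀ b → PrimeDisjoint b (b + 1)
primeDisjoint-+1 b pq q∣b q∣b+1 = prime⇒≢1 pq (∣1⇒≡1 (∣m+n∣m⇒∣n q∣b+1 q∣b))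

primeDisjoint-^ : ∀ {p r} a → Prime p → ¬ p ∣ r → PrimeDisjoint (p ^ a) r
primeDisjoint-^ a pp p∤r pq q∣p^a with prime∣p^n⇒≡ a pq pp q∣p^a
... | refl = p∤r

val-*-∤ : ∀ {p x y} → Prime p → 0 < x → ¬ p ∣ y → val p (x * y) ≡ val p x
val-*-∤ {p} {x} {y} pp x>0 p∤y with factor-out-power p {{prime⇒nonTrivial pp}} x x>0
... | a , r , refl , p∤r = begin
  val p (p ^ a * r * y)    ≡⟨ cong (val p) (*-assoc (p ^ a) r y) ⟩
  val p (p ^ a * (r * y))  ≡⟨ val-^* p {{prime⇒nonTrivial pp}} a (prime∤-* pp p∤r p∤y) ⟩
  a                        ≡⟨ val-^* p {{prime⇒nonTrivial pp}} a p∤r ⟨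
  val p (p ^ a * r)        ∎
  where open ≡-Reasoning

-- The exponential of μ, prime by prime

-- rad m * expProd m = e^μ(m) regrouped as the product over the primes q ∣ m of q · v_q(m).
radExpFactor : ℕ → ℕ → ℕ
radExpFactor q m = if does (prime? q) ∧ does (q ∣? m) then q * val q m else 1

radExpUpTo : ℕ → ℕ → ℕ
radExpUpTo zero    m = 1
radExpUpTo (suc K) m = radExpFactor (suc K) m * radExpUpTo K m

if-*-if : ∀ c {x y} → (if c then x else 1) * (if c then y else 1) ≡ (if c then x * y else 1)
if-*-if true  = refl
if-*-if false = refl

radUpTo*expUpTo≡radExpUpTo : ∀ m K → radUpTo m K * expUpTo m K ≡ radExpUpTo K m
radUpTo*expUpTo≡radExpUpTo m zero    = refl
radUpTo*expUpTo≡radExpUpTo m (suc K) =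
  trans (interchange (if c then suc K else 1) (radUpTo m K)
                     (if c then val (suc K) m else 1) (expUpTo m K))
        (cong₂ _*_ (if-*-if c) (radUpTo*expUpTo≡radExpUpTo m K))
  where c = does (prime? (suc K)) ∧ does (suc K ∣? m)

radExpFactor-¬prime : ∀ {q m} → ¬ Prime q → radExpFactor q m ≡ 1
radExpFactor-¬prime {q} ¬pq rewrite dec-false (prime? q) ¬pq = refl

radExpFactor-∤ : ∀ {q m} → ¬ q ∣ m → radExpFactor q m ≡ 1
radExpFactor-∤ {q} {m} q∤m
  rewrite dec-false (q ∣? m) q∤m | ∧-zeroʳ (does (prime? q)) = refl

radExpFactor-∣ : ∀ {q m} → Prime q → q ∣ m → radExpFactor q m ≡ q * val q m
radExpFactor-∣ {q} {m} pq q∣m rewrite dec-true (prime? q) pq | dec-true (q ∣? m) q∣m = refl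

radExpFactor-*-∤ : ∀ {q x y} → 0 < x → ¬ q ∣ y →
                   radExpFactor q (x * y) ≡ radExpFactor q x
radExpFactor-*-∤ {q} {x} {y} x>0 q∤y with toSum (prime? q) | toSum (q ∣? x)
... | inj₂ ¬pq | _ = trans (radExpFactor-¬prime ¬pq) (sym (radExpFactor-¬prime ¬pq))
... | inj₁ pq | inj₁ q∣x = begin
  radExpFactor q (x * y)  ≡⟨ radExpFactor-∣ pq (∣m⇒∣m*n y q∣x) ⟩
  q * val q (x * y)       ≡⟨ cong (q *_) (val-*-∤ pq x>0 q∤y) ⟩
  q * val q x             ≡⟨ radExpFactor-∣ pq q∣x ⟨
  radExpFactor q x        ∎
  where open ≡-Reasoning
... | inj₁ pq | inj₂ q∤x =
  trans (radExpFactor-∤ (prime∤-* pq q∤x q∤y)) (sym (radExpFactor-∤ q∤x))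

radExpFactor-* : ∀ q {x y} → 0 < x → 0 < y → PrimeDisjoint x y →
                 radExpFactor q (x * y) ≡ radExpFactor q x * radExpFactor q y
radExpFactor-* q {x} {y} x>0 y>0 x⊥y with toSum (q ∣? y) | toSum (prime? q)
... | inj₂ q∤y | _ = begin
  radExpFactor q (x * y)               ≡⟨ radExpFactor-*-∤ x>0 q∤y ⟩
  radExpFactor q x                     ≡⟨ *-identityʳ _ ⟨
  radExpFactor q x * 1                 ≡⟨ cong (radExpFactor q x *_) (radExpFactor-∤ q∤y) ⟨
  radExpFactor q x * radExpFactor q y  ∎
  where open ≡-Reasoning
... | inj₁ _ | inj₂ ¬pq =
  trans (radExpFactor-¬prime ¬pq)
        (sym (cong₂ _*_ (radExpFactor-¬prime ¬pq) (radExpFactor-¬prime ¬pq)))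
... | inj₁ q∣y | inj₁ pq = begin
  radExpFactor q (x * y)               ≡⟨ cong (radExpFactor q) (*-comm x y) ⟩
  radExpFactor q (y * x)               ≡⟨ radExpFactor-*-∤ y>0 q∤x ⟩
  radExpFactor q y                     ≡⟨ *-identityˡ _ ⟨
  1 * radExpFactor q y                 ≡⟨ cong (_* radExpFactor q y) (radExpFactor-∤ q∤x) ⟨
  radExpFactor q x * radExpFactor q y  ∎
  where
  open ≡-Reasoning
  q∤x : ¬ q ∣ x
  q∤x q∣x = x⊥y pq q∣x q∣y

radExpUpTo-* : ∀ K {x y} → 0 < x → 0 < y → PrimeDisjoint x y →
               radExpUpTo K (x * y) ≡ radExpUpTo K x * radExpUpTo K y
radExpUpTo-* zero            x>0 y>0 x⊥y = refl
radExpUpTo-* (suc K) {x} {y} x>0 y>0 x⊥y =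
  trans (cong₂ _*_ (radExpFactor-* (suc K) x>0 y>0 x⊥y) (radExpUpTo-* K x>0 y>0 x⊥y))
        (interchange (radExpFactor (suc K) x) (radExpFactor (suc K) y)
                     (radExpUpTo K x) (radExpUpTo K y))

radExpUpTo-suc : ∀ {K x} → radExpFactor (suc K) x ≡ 1 →
                 radExpUpTo (suc K) x ≡ radExpUpTo K x
radExpUpTo-suc {K} {x} eq = trans (cong (_* radExpUpTo K x) eq) (*-identityˡ _)

radExpFactor-^ : ∀ {q p} e → Prime p → q ≢ p → radExpFactor q (p ^ e) ≡ 1
radExpFactor-^ {q} e pp q≢p with toSum (prime? q)
... | inj₁ pq  = radExpFactor-∤ (q≢p ∘ prime∣p^n⇒≡ e pq pp)
... | inj₂ ¬pq = radExpFactor-¬prime ¬pq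

radExpUpTo-^-< : ∀ {p} e → Prime p → ∀ {K} → K < p → radExpUpTo K (p ^ e) ≡ 1
radExpUpTo-^-< e pp {zero}  _     = refl
radExpUpTo-^-< e pp {suc K} 1+K<p =
  cong₂ _*_ (radExpFactor-^ e pp (<⇒≢ 1+K<p))
            (radExpUpTo-^-< e pp (<-trans (n<1+n K) 1+K<p))

radExpUpTo-^≤ : ∀ {p e} → Prime p → 0 < e → ∀ K → radExpUpTo K (p ^ e) ≤ p * e
radExpUpTo-^≤ pp e>0 zero = *-mono-≤ (<⇒≤ (prime⇒>1 pp)) e>0
radExpUpTo-^≤ {p} {e} pp e>0 (suc K) with suc K ≟ p
... | yes refl = ≤-reflexive (begin
  radExpFactor p (p ^ e) * radExpUpTo K (p ^ e)  ≡⟨ cong₂ _*_ (radExpFactor-∣ pp (p∣p^n e>0))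
                                                              (radExpUpTo-^-< e pp (n<1+n K)) ⟩
  p * val p (p ^ e) * 1                          ≡⟨ *-identityʳ _ ⟩
  p * val p (p ^ e)                              ≡⟨ cong (p *_) p-val ⟩
  p * e                                          ∎)
  where
  open ≡-Reasoning
  p-val = val-^ p {{prime⇒nonTrivial pp}} e
... | no 1+K≢p = begin
  radExpUpTo (suc K) (p ^ e)  ≡⟨ radExpUpTo-suc {K} (radExpFactor-^ e pp 1+K≢p) ⟩
  radExpUpTo K (p ^ e)        ≤⟨ radExpUpTo-^≤ pp e>0 K ⟩
  p * e                       ∎
  where open ≤-Reasoning

radExpUpTo≤ : ∀ K {x} → 0 < x → radExpUpTo K x ≤ x
radExpUpTo≤ zero x>0 = x>0
radExpUpTo≤ (suc K) {x} x>0 with toSum (prime? (suc K)) | toSum (suc K ∣? x)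
... | inj₂ ¬pq | _ =
  ≤-trans (≤-reflexive (radExpUpTo-suc {K} {x} (radExpFactor-¬prime {m = x} ¬pq))) (radExpUpTo≤ K x>0)
... | inj₁ _ | inj₂ q∤x =
  ≤-trans (≤-reflexive (radExpUpTo-suc {K} {x} (radExpFactor-∤ q∤x))) (radExpUpTo≤ K x>0)
... | inj₁ pq | inj₁ q∣x with factor-out-power (suc K) {{prime⇒nonTrivial pq}} x x>0
...   | zero , r , refl , q∤r = contradiction (subst (suc K ∣_) (*-identityˡ r) q∣x) q∤r
...   | a@(suc _) , r , refl , q∤r = begin
  radExpFactor q (q ^ a * r) * radExpUpTo K (q ^ a * r)
    ≡⟨ cong₂ _*_ (radExpFactor-∣ pq q∣x)
                 (radExpUpTo-* K (m^n>0 q a) r>0 (primeDisjoint-^ a pq q∤r)) ⟩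
  q * val q (q ^ a * r) * (radExpUpTo K (q ^ a) * radExpUpTo K r)
    ≡⟨ cong₂ (λ v u → q * v * (u * radExpUpTo K r))
             (val-^* q {{prime⇒nonTrivial pq}} a q∤r) (radExpUpTo-^-< a pq (n<1+n K)) ⟩
  q * a * (1 * radExpUpTo K r)
    ≤⟨ *-monoʳ-≤ (q * a) (≤-trans (≤-reflexive (*-identityˡ _)) (radExpUpTo≤ K r>0)) ⟩
  q * a * r
    ≤⟨ *-monoˡ-≤ r (p*n≤p^n (prime⇒>1 pq) {a} z<s) ⟩
  q ^ a * r
    ∎
  where
  open ≤-Reasoning
  q = suc K
  r>0 = ∤⇒>0 q∤r

radExpUpTo-^*≤ : ∀ {p k c} → Prime p → 0 < k → 0 < c → ∀ K →
                 radExpUpTo K (p ^ k * c) ≤ p * k * c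
radExpUpTo-^*≤ {p} {k} {c} pp k>0 c>0 K with factor-out-power p {{prime⇒nonTrivial pp}} c c>0
... | t , c′ , refl , p∤c′ = begin
  radExpUpTo K (p ^ k * (p ^ t * c′))           ≡⟨ cong (radExpUpTo K) p^k*[p^t*c′]≡p^[k+t]*c′ ⟩
  radExpUpTo K (p ^ (k + t) * c′)               ≡⟨ radExpUpTo-* K p^[k+t]>0 c′>0
                                                     (primeDisjoint-^ (k + t) pp p∤c′) ⟩
  radExpUpTo K (p ^ (k + t)) * radExpUpTo K c′  ≤⟨ *-mono-≤ (radExpUpTo-^≤ pp k+t>0 K)
                                                            (radExpUpTo≤ K c′>0) ⟩
  p * (k + t) * c′                              ≤⟨ *-monoˡ-≤ c′ (*-monoʳ-≤ p
                                                     (m+n≤m*p^n (prime⇒>1 pp) t k>0)) ⟩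
  p * (k * p ^ t) * c′                          ≡⟨ cong (_* c′) (*-assoc p k (p ^ t)) ⟨
  p * k * p ^ t * c′                            ≡⟨ *-assoc (p * k) (p ^ t) c′ ⟩
  p * k * (p ^ t * c′)                          ∎
  where
  open ≤-Reasoning
  c′>0 = ∤⇒>0 p∤c′
  p^[k+t]>0 = m^n>0 p {{prime⇒nonZero pp}} (k + t)
  k+t>0 = ≤-trans k>0 (m≤m+n k t)
  p^k*[p^t*c′]≡p^[k+t]*c′ : p ^ k * (p ^ t * c′) ≡ p ^ (k + t) * c′
  p^k*[p^t*c′]≡p^[k+t]*c′ =
    trans (sym (*-assoc (p ^ k) (p ^ t) c′)) (cong (_* c′) (sym (^-distribˡ-+-* p k t)))

-- μ-hits of the form (1, b, b + 1)

μ-hit-consecutive : ∀ {b} → 0 < b →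
                    (∀ K → radExpUpTo K b * radExpUpTo K (b + 1) < b + 1) →
                    μ-hit 1 b (b + 1)
μ-hit-consecutive {b} b>0 small = ≤-refl , b>0 , +-comm 1 b , gcd-zeroˡ b , (begin-strict
  rad M * expProd M                      ≡⟨ radUpTo*expUpTo≡radExpUpTo M M ⟩
  radExpUpTo M (1 * b * (b + 1))         ≡⟨ cong (λ x → radExpUpTo M (x * (b + 1)))
                                                  (*-identityˡ b) ⟩
  radExpUpTo M (b * (b + 1))             ≡⟨ radExpUpTo-* M b>0 (m≤n+m 1 b) (primeDisjoint-+1 b) ⟩
  radExpUpTo M b * radExpUpTo M (b + 1)  <⟨ small M ⟩
  b + 1                                  ∎)
  where
  open ≤-Reasoning
  M = 1 * b * (b + 1)

4*[m*n]≤[m+n]*[m+n] : ∀ m n → 4 * (m * n) ≤ (m + n) * (m + n)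
4*[m*n]≤[m+n]*[m+n] zero    n       = z≤n
4*[m*n]≤[m+n]*[m+n] (suc m) zero    = ≤-trans (≤-reflexive (cong (4 *_) (*-zeroʳ (suc m)))) z≤n
4*[m*n]≤[m+n]*[m+n] (suc m) (suc n) = begin
  4 * (suc m * suc n)                  ≡⟨ solve (m ∷ n ∷ []) ⟩
  4 * (m * n) + 4 * (m + n + 1)        ≤⟨ +-monoˡ-≤ _ (4*[m*n]≤[m+n]*[m+n] m n) ⟩
  (m + n) * (m + n) + 4 * (m + n + 1)  ≡⟨ solve (m ∷ n ∷ []) ⟩
  (suc m + suc n) * (suc m + suc n)    ∎
  where open ≤-Reasoning

R*[2+2L]<2^[1+L] : ∀ k L {J c R} → 4 * (R * suc L) ≤ J * c →
                   J * (2 ^ k * c) < 2 ^ (suc k + L + 1) → R * (2 * suc L) < 2 ^ suc L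
R*[2+2L]<2^[1+L] k L {J} {c} {R} 4R[1+L]≤Jc small = begin-strict
  R * (2 * suc L)  ≡⟨ x∙yz≈y∙xz R 2 (suc L) ⟩
  2 * (R * suc L)  <⟨ *-monoʳ-< 2 R[1+L]<2^L ⟩
  2 ^ suc L        ∎
  where
  open ≤-Reasoning
  exponent : suc k + L + 1 ≡ 2 + L + k
  exponent = solve (k ∷ L ∷ [])
  2^[k+L+2]≡4*2^L*2^k : 2 ^ (suc k + L + 1) ≡ 4 * 2 ^ L * 2 ^ k
  2^[k+L+2]≡4*2^L*2^k = begin-equality
    2 ^ (suc k + L + 1)      ≡⟨ cong (2 ^_) exponent ⟩
    2 ^ (2 + L + k)          ≡⟨ ^-distribˡ-+-* 2 (2 + L) k ⟩
    2 * (2 * 2 ^ L) * 2 ^ k  ≡⟨ cong (_* 2 ^ k) (*-assoc 2 2 (2 ^ L)) ⟨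
    4 * 2 ^ L * 2 ^ k        ∎
  Jc<4*2^L : J * c < 4 * 2 ^ L
  Jc<4*2^L = *-cancelʳ-< (2 ^ k) (J * c) (4 * 2 ^ L)
    (subst₂ _<_ (x∙yz≈xz∙y J (2 ^ k) c) 2^[k+L+2]≡4*2^L*2^k small)
  R[1+L]<2^L : R * suc L < 2 ^ L
  R[1+L]<2^L = *-cancelˡ-< 4 (R * suc L) (2 ^ L) (≤-<-trans 4R[1+L]≤Jc Jc<4*2^L)

radExpUpTo-3^k*c-bound : ∀ k L {c} → 2 ≤ suc k + L → 0 < c →
  ∃[ R ] (∀ K → radExpUpTo K (3 ^ k * c) ≤ R)
       × 4 * (R * suc L) ≤ 3 * ((suc k + L) * (suc k + L)) * c
radExpUpTo-3^k*c-bound zero L {c} 2≤1+L c>0 = c , radExp-c≤c , (begin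
  4 * (c * suc L)          ≡⟨ solve (c ∷ L ∷ []) ⟩
  4 * suc L * c            ≤⟨ *-monoˡ-≤ c (*-monoˡ-≤ (suc L) 4≤3[1+L]) ⟩
  3 * suc L * suc L * c    ≡⟨ cong (_* c) (*-assoc 3 (suc L) (suc L)) ⟩
  3 * (suc L * suc L) * c  ∎)
  where
  open ≤-Reasoning
  radExp-c≤c : ∀ K → radExpUpTo K (1 * c) ≤ c
  radExp-c≤c K = ≤-trans (radExpUpTo≤ K (*-monoʳ-≤ 1 c>0)) (≤-reflexive (*-identityˡ c))
  4≤3[1+L] : 4 ≤ 3 * suc L
  4≤3[1+L] = ≤-trans (s≤s (s≤s (s≤s (s≤s z≤n)))) (*-monoʳ-≤ 3 2≤1+L)
radExpUpTo-3^k*c-bound (suc k) L {c} _ c>0 =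
  3 * suc k * c , radExpUpTo-^*≤ {k = suc k} prime[3] z<s c>0 , (begin
  4 * (3 * suc k * c * suc L)                  ≡⟨ solve (k ∷ c ∷ L ∷ []) ⟩
  3 * (4 * (suc k * suc L)) * c                ≤⟨ *-monoˡ-≤ c (*-monoʳ-≤ 3 am-gm) ⟩
  3 * ((suc k + suc L) * (suc k + suc L)) * c  ≡⟨ cong (λ j → 3 * (j * j) * c)
                                                       (+-suc (suc k) L) ⟩
  3 * ((2 + k + L) * (2 + k + L)) * c          ∎)
  where
  open ≤-Reasoning
  am-gm = 4*[m*n]≤[m+n]*[m+n] (suc k) (suc L)

μ-hit-3^k*c : ∀ k L {c d} → 2 ≤ suc k + L → 0 < c →
  3 * ((suc k + L) * (suc k + L)) * (2 ^ k * c) < 2 ^ (suc k + L + 1) →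
  3 ^ k * c + 1 ≡ 2 ^ suc L * d → μ-hit 1 (3 ^ k * c) (3 ^ k * c + 1)
μ-hit-3^k*c k L {c} {d} j≥2 c>0 small b+1≡2^[1+L]*d with radExpUpTo-3^k*c-bound k L j≥2 c>0
... | R , radExp-b≤R , 4R[1+L]≤ = μ-hit-consecutive b>0 λ K → begin-strict
  radExpUpTo K b * radExpUpTo K (b + 1)  ≤⟨ *-mono-≤ (radExp-b≤R K) (radExp-b+1≤ K) ⟩
  R * (2 * suc L * d)                    ≡⟨ *-assoc R (2 * suc L) d ⟨
  R * (2 * suc L) * d                    <⟨ *-monoˡ-< d {{>-nonZero d>0}} R-small ⟩
  2 ^ suc L * d                          ≡⟨ b+1≡2^[1+L]*d ⟨
  b + 1                                  ∎
  where
  open ≤-Reasoning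
  b = 3 ^ k * c
  b>0 : 0 < b
  b>0 = *-mono-≤ (m^n>0 3 k) c>0
  d>0 : 0 < d
  d>0 = m*n>0⇒n>0 (2 ^ suc L) (subst (0 <_) b+1≡2^[1+L]*d (m≤n+m 1 b))
  R-small : R * (2 * suc L) < 2 ^ suc L
  R-small = R*[2+2L]<2^[1+L] k L {J = 3 * ((suc k + L) * (suc k + L))} {R = R} 4R[1+L]≤ small
  radExp-b+1≤ : ∀ K → radExpUpTo K (b + 1) ≤ 2 * suc L * d
  radExp-b+1≤ K rewrite b+1≡2^[1+L]*d = radExpUpTo-^*≤ {k = suc L} prime[2] z<s d>0 K

-- The Collatz map

%2≢0⇒%2≡1 : ∀ x → x % 2 ≢ 0 → x % 2 ≡ 1
%2≢0⇒%2≡1 x x%2≢0 with x % 2 | m%n<n x 2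
... | zero        | _ = contradiction refl x%2≢0
... | suc zero    | _ = refl
... | suc (suc _) | s≤s (s≤s ())

%2≡0⇒[+1]%2≡1 : ∀ x → x % 2 ≡ 0 → (x + 1) % 2 ≡ 1
%2≡0⇒[+1]%2≡1 x x%2≡0 = trans (%-distribˡ-+ x 1 2) (cong (λ r → (r + 1) % 2) x%2≡0)

T-even : ∀ x → x % 2 ≡ 0 → 2 * T x ≡ x
T-even x x%2≡0 = begin
  2 * T x            ≡⟨ cong (λ e → 2 * (if e then x / 2 else (3 * x + 1) / 2))
                             (dec-true (x % 2 ≟ 0) x%2≡0) ⟩
  2 * (x / 2)        ≡⟨ *-comm 2 (x / 2) ⟩
  x / 2 * 2          ≡⟨ cong (_+ x / 2 * 2) x%2≡0 ⟨
  x % 2 + x / 2 * 2  ≡⟨ m≡m%n+[m/n]*n x 2 ⟨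
  x                  ∎
  where open ≡-Reasoning

T-odd : ∀ x → x % 2 ≡ 1 → 2 * (T x + 1) ≡ 3 * (x + 1)
T-odd x x%2≡1 = begin
  2 * (T x + 1)        ≡⟨ cong (λ t → 2 * (t + 1)) T[x]≡2+3h ⟩
  2 * (2 + 3 * h + 1)  ≡⟨ 2*[3+3h]≡3*[2+2h] h ⟩
  3 * (1 + h * 2 + 1)  ≡⟨ cong (λ z → 3 * (z + 1)) x≡1+h*2 ⟨
  3 * (x + 1)          ∎
  where
  open ≡-Reasoning
  h = x / 2
  2*[3+3h]≡3*[2+2h] : ∀ h → 2 * (2 + 3 * h + 1) ≡ 3 * (1 + h * 2 + 1)
  2*[3+3h]≡3*[2+2h] h = solve (h ∷ [])
  3*[1+2h]+1≡[2+3h]*2 : ∀ h → 3 * (1 + h * 2) + 1 ≡ (2 + 3 * h) * 2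
  3*[1+2h]+1≡[2+3h]*2 h = solve (h ∷ [])
  x%2≢0 : x % 2 ≢ 0
  x%2≢0 x%2≡0 = 0≢1+n (trans (sym x%2≡0) x%2≡1)
  x≡1+h*2 : x ≡ 1 + h * 2
  x≡1+h*2 = trans (m≡m%n+[m/n]*n x 2) (cong (_+ h * 2) x%2≡1)
  T[x]≡2+3h : T x ≡ 2 + 3 * h
  T[x]≡2+3h = begin
    T x                        ≡⟨ cong (λ e → if e then x / 2 else (3 * x + 1) / 2)
                                       (dec-false (x % 2 ≟ 0) x%2≢0) ⟩
    (3 * x + 1) / 2            ≡⟨ cong (λ z → (3 * z + 1) / 2) x≡1+h*2 ⟩
    (3 * (1 + h * 2) + 1) / 2  ≡⟨ cong (_/ 2) (3*[1+2h]+1≡[2+3h]*2 h) ⟩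
    (2 + 3 * h) * 2 / 2        ≡⟨ m*n/n≡m (2 + 3 * h) 2 ⟩
    2 + 3 * h                  ∎

T^-+ : ∀ i k n → T^ i (T^ k n) ≡ T^ (i + k) n
T^-+ zero    k n = refl
T^-+ (suc i) k n = cong T (T^-+ i k n)

OddRun : ℕ → ℕ → Set
OddRun m L = ∀ {i} → i < L → T^ i m % 2 ≡ 1

odd-run : ∀ m L → OddRun m L → 2 ^ L * (T^ L m + 1) ≡ 3 ^ L * (m + 1)
odd-run m zero    _   = refl
odd-run m (suc L) odd = begin
  2 * 2 ^ L * (T x + 1)    ≡⟨ *-assoc 2 (2 ^ L) (T x + 1) ⟩
  2 * (2 ^ L * (T x + 1))  ≡⟨ x∙yz≈y∙xz 2 (2 ^ L) (T x + 1) ⟩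
  2 ^ L * (2 * (T x + 1))  ≡⟨ cong (2 ^ L *_) (T-odd x (odd (n<1+n L))) ⟩
  2 ^ L * (3 * (x + 1))    ≡⟨ x∙yz≈y∙xz (2 ^ L) 3 (x + 1) ⟩
  3 * (2 ^ L * (x + 1))    ≡⟨ cong (3 *_) (odd-run m L (odd ∘ m<n⇒m<1+n)) ⟩
  3 * (3 ^ L * (m + 1))    ≡⟨ *-assoc 3 (3 ^ L) (m + 1) ⟨
  3 * 3 ^ L * (m + 1)      ∎
  where
  open ≡-Reasoning
  x = T^ L m

odd-run-shape : ∀ m L → OddRun m L →
                ∃[ c ] 0 < c × m + 1 ≡ 2 ^ L * c × T^ L m + 1 ≡ 3 ^ L * c
odd-run-shape m L odd = c , c>0 , m+1≡2^L*c , T^Lm+1≡3^L*c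
  where
  run = odd-run m L odd
  2∤3^L : ¬ 2 ∣ 3 ^ L
  2∤3^L 2∣3^L = contradiction (prime∣p^n⇒≡ L prime[2] prime[3] 2∣3^L) λ ()
  2^L∣m+1 : 2 ^ L ∣ m + 1
  2^L∣m+1 = p^n∣m*x⇒p^n∣x prime[2] 2∤3^L L
              (divides (T^ L m + 1) (trans (sym run) (*-comm (2 ^ L) (T^ L m + 1))))
  c = quotient 2^L∣m+1
  m+1≡2^L*c : m + 1 ≡ 2 ^ L * c
  m+1≡2^L*c = m∣n⇒n≡m*quotient 2^L∣m+1
  c>0 : 0 < c
  c>0 = m*n>0⇒n>0 (2 ^ L) (subst (0 <_) m+1≡2^L*c (m≤n+m 1 m))
  T^Lm+1≡3^L*c : T^ L m + 1 ≡ 3 ^ L * c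
  T^Lm+1≡3^L*c = *-cancelˡ-≡ (T^ L m + 1) (3 ^ L * c) (2 ^ L) {{m^n≢0 2 L}} (begin
    2 ^ L * (T^ L m + 1)  ≡⟨ run ⟩
    3 ^ L * (m + 1)       ≡⟨ cong (3 ^ L *_) m+1≡2^L*c ⟩
    3 ^ L * (2 ^ L * c)   ≡⟨ x∙yz≈y∙xz (3 ^ L) (2 ^ L) c ⟩
    2 ^ L * (3 ^ L * c)   ∎)
    where open ≡-Reasoning

even-step : ∀ x {L d} → x % 2 ≡ 0 → T x + 1 ≡ 2 ^ L * d → x + 1 + 1 ≡ 2 ^ suc L * d
even-step x {L} {d} x%2≡0 Tx+1≡2^L*d = begin
  x + 1 + 1        ≡⟨ cong (λ y → y + 1 + 1) (T-even x x%2≡0) ⟨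
  2 * T x + 1 + 1  ≡⟨ 2t+1+1≡2*[t+1] (T x) ⟩
  2 * (T x + 1)    ≡⟨ cong (2 *_) Tx+1≡2^L*d ⟩
  2 * (2 ^ L * d)  ≡⟨ *-assoc 2 (2 ^ L) d ⟨
  2 ^ suc L * d    ∎
  where
  open ≡-Reasoning
  2t+1+1≡2*[t+1] : ∀ t → 2 * t + 1 + 1 ≡ 2 * (t + 1)
  2t+1+1≡2*[t+1] t = solve (t ∷ [])

countEven-even : ∀ j n → T^ j n % 2 ≡ 0 → countEven (suc j) n ≡ suc (countEven j n)
countEven-even j n even =
  cong (λ e → (if e then 1 else 0) + countEven j n) (dec-true (T^ j n % 2 ≟ 0) even)

countEven-odd : ∀ j n → T^ j n % 2 ≢ 0 → countEven (suc j) n ≡ countEven j n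
countEven-odd j n odd =
  cong (λ e → (if e then 1 else 0) + countEven j n) (dec-false (T^ j n % 2 ≟ 0) odd)

countEven≡0⇒oddRun : ∀ j n → countEven j n ≡ 0 → OddRun n j
countEven≡0⇒oddRun (suc j) n none {i} i<1+j with toSum (T^ j n % 2 ≟ 0) | m<1+n⇒m<n∨m≡n i<1+j
... | inj₁ j-even | _         = contradiction (trans (sym (countEven-even j n j-even)) none) λ ()
... | inj₂ j-odd  | inj₁ i<j  =
  countEven≡0⇒oddRun j n (trans (sym (countEven-odd j n j-odd)) none) i<j
... | inj₂ j-odd  | inj₂ refl = %2≢0⇒%2≡1 (T^ j n) j-odd

countEven≡1⇒uniqueEven : ∀ j n → countEven j n ≡ 1 →
  ∃[ k ] k < j × T^ k n % 2 ≡ 0 × (∀ {i} → i < j → i ≢ k → T^ i n % 2 ≡ 1)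
countEven≡1⇒uniqueEven (suc j) n one with toSum (T^ j n % 2 ≟ 0)
... | inj₁ j-even = j , n<1+n j , j-even , others-odd
  where
  none : countEven j n ≡ 0
  none = suc-injective (trans (sym (countEven-even j n j-even)) one)
  others-odd : ∀ {i} → i < suc j → i ≢ j → T^ i n % 2 ≡ 1
  others-odd i<1+j i≢j with m<1+n⇒m<n∨m≡n i<1+j
  ... | inj₁ i<j = countEven≡0⇒oddRun j n none i<j
  ... | inj₂ i≡j = contradiction i≡j i≢j
... | inj₂ j-odd with countEven≡1⇒uniqueEven j n (trans (sym (countEven-odd j n j-odd)) one)
...   | k , k<j , k-even , odd = k , m<n⇒m<1+n k<j , k-even , others-odd
  where
  others-odd : ∀ {i} → i < suc j → i ≢ k → T^ i n % 2 ≡ 1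
  others-odd i<1+j i≢k with m<1+n⇒m<n∨m≡n i<1+j
  ... | inj₁ i<j  = odd i<j i≢k
  ... | inj₂ refl = %2≢0⇒%2≡1 (T^ j n) j-odd

uniqueEven-decomposition : ∀ k L n → T^ k n % 2 ≡ 0 →
  (∀ {i} → i < suc k + L → i ≢ k → T^ i n % 2 ≡ 1) →
  ∃₂ λ c d → 0 < c × n + 1 ≡ 2 ^ k * c
           × T^ k n + 1 ≡ 3 ^ k * c × T^ k n + 1 + 1 ≡ 2 ^ suc L * d
uniqueEven-decomposition k L n k-even odd =
  let c , c>0 , n+1≡2^k*c , x+1≡3^k*c = odd-run-shape n k odd-before
      d , _   , Tx+1≡2^L*d , _         = odd-run-shape (T^ (suc k) n) L odd-after
  in  c , d , c>0 , n+1≡2^k*c , x+1≡3^k*c , even-step (T^ k n) {L} k-even Tx+1≡2^L*d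
  where
  odd-before : OddRun n k
  odd-before i<k = odd (<-trans i<k (m≤m+n (suc k) L)) (<⇒≢ i<k)
  odd-after : OddRun (T^ (suc k) n) L
  odd-after {i} i<L = subst (λ y → y % 2 ≡ 1) (sym (T^-+ i (suc k) n))
    (odd (subst (_< suc k + L) (+-comm (suc k) i) (+-monoʳ-< (suc k) i<L))
         (≢-sym (<⇒≢ (m≤n+m (suc k) i))))

uniqueEven⇒μ-hit : ∀ k L n → 2 ≤ suc k + L →
  3 * ((suc k + L) * (suc k + L)) * (n + 1) < 2 ^ (suc k + L + 1) →
  T^ k n % 2 ≡ 0 → (∀ {i} → i < suc k + L → i ≢ k → T^ i n % 2 ≡ 1) →
  μ-hit 1 (T^ k n + 1) (T^ k n + 1 + 1)
uniqueEven⇒μ-hit k L n j≥2 small k-even odd with uniqueEven-decomposition k L n k-even odd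
... | c , d , c>0 , n+1≡2^k*c , x+1≡3^k*c , x+2≡2^[1+L]*d rewrite x+1≡3^k*c =
  μ-hit-3^k*c k L j≥2 c>0 (subst (λ m → J * m < 2 ^ (suc k + L + 1)) n+1≡2^k*c small)
              x+2≡2^[1+L]*d
  where J = 3 * ((suc k + L) * (suc k + L))

theorem2 : (j n : ℕ) → 2 ≤ j → 1 ≤ n → countEven j n ≡ 1 →
    (2 ^ (j + 1) ≤ 3 * (j * j) * (n + 1))
    ⊎ Σ ℕ (λ k → k < j × (T^ k n + 1) % 2 ≡ 1
        × μ-hit 1 (T^ k n + 1) (T^ k n + 1 + 1))
theorem2 j n j≥2 _ one with 2 ^ (j + 1) ≤? 3 * (j * j) * (n + 1)
... | yes large = inj₁ large
... | no ¬large with countEven≡1⇒uniqueEven j n one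
...   | k , k<j , k-even , odd with m≤n⇒∃[o]m+o≡n k<j
...     | L , refl = inj₂ (k , k<j , %2≡0⇒[+1]%2≡1 (T^ k n) k-even ,
                           uniqueEven⇒μ-hit k L n j≥2 (≰⇒> ¬large) k-even odd)
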